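{- Let $d$ be a positive integer and $\preceq$ a 1-graded relaxed monomial order on $\mathbb{N}^d$ with $\mathbf{e}_1\prec\mathbf{e}_2\prec\cdots\prec\mathbf{e}_d$. Let $S\in\operatorname{R}_\preceq(\mathcal{S}_d)$ and suppose $\operatorname{H}(S)\cap\{\mathbf{e}_1,\ldots,\mathbf{e}_d\}=\{\mathbf{e}_{j_1}\prec\mathbf{e}_{j_2}\prec\cdots\prec\mathbf{e}_{j_r}\}$ for some $\{j_1,\ldots,j_r\}\subseteq\{1,\ldots,d\}$, $r\leq d$. Then $\{\mathbf{e}_{j_1},\ldots,\mathbf{e}_{j_r}\}=\{\mathbf{e}_1,\ldots,\mathbf{e}_r\}$.
   Context: $\mathbf{e}_1,\ldots,\mathbf{e}_d$ are the standard basis vectors of $\mathbb{R}^d$. A generalized numerical semigroup (GNS) in $\mathbb{N}^d$ is a submonoid $S$ of $(\mathbb{N}^d,+)$ with $\operatorname{H}(S)=\mathbb{N}^d\setminus S$ finite; $|\operatorname{H}(S)|$ is its genus; $\mathcal{S}_d$ is the set of GNSs in $\mathbb{N}^d$ and $\mathcal{S}_{g,d}$ those of genus $g$. $\operatorname{P}_d$ is the set of permutations of $\{1,\ldots,d\}$, acting by $\sigma(\sum x_i\mathbf{e}_i)=\sum x_i\mathbf{e}_{\sigma(i)}$ and elementwise on sets; $[S]_\simeq=\{\sigma(S)\mid\sigma\in\operatorname{P}_d\}$. A relaxed monomial order is a total order $\preceq$ on $\mathbb{N}^d$ with $\mathbf{0}\preceq\mathbf{v}$ for all $\mathbf{v}$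 and such that $\mathbf{v}\prec\mathbf{w}$ implies $\mathbf{v}\prec\mathbf{w}+\mathbf{u}$ for all $\mathbf{u}$; it is 1-graded if every $\mathbf{n}\in\mathbb{N}^d\setminus\{\mathbf{0},\mathbf{e}_1,\ldots,\mathbf{e}_d\}$ satisfies $\mathbf{n}\succ\max_\preceq\{\mathbf{e}_1,\ldots,\mathbf{e}_d\}$. For $S,S'\in\mathcal{S}_{g,d}$ with gaps $\mathbf{h}_1\prec\cdots\prec\mathbf{h}_g$ and $\mathbf{h}'_1\prec\cdots\prec\mathbf{h}'_g$, $S\preceq_{\operatorname{R}}S'$ means $S=S'$ or $\mathbf{h}_r\prec\mathbf{h}'_r$ for $r=\min\{i\mid\mathbf{h}_i\neq\mathbf{h}'_i\}$; $\operatorname{R}_\preceq(S)=\min_{\preceq_{\operatorname{R}}}[S]_\simeq$ and $\operatorname{R}_\preceq(\mathcal{S}_d)=\{\operatorname{R}_\preceq(S)\mid S\in\mathcal{S}_d\}$. -}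

module Defs where

open import Data.Nat using (ℕ; zero; suc)
import Data.Nat as ℕ
open import Data.Fin using (Fin; toℕ)
import Data.Fin as F
open import Data.Vec using (Vec; zipWith; replicate; tabulate; lookup)
open import Data.List using (List; []; _∷_; map)
open import Data.List.Membership.Propositional using (_∈_; _∉_)
open import Data.List.Relation.Unary.Unique.Propositional using (Unique)
open import Data.List.Relation.Binary.Permutation.Propositional using (_↭_)
open import Data.List.Relation.Unary.Linked using (Linked)
open import Data.Fin.Permutation using (Permutation′; _⟨$⟩ˡ_)
open import Data.Product using (Σ; _×_; _,_)
open import Data.Sum using (_⊎_)
open import Relation.Nullary using (¬_; does)
open import Relation.Binary using (Rel; IsTotalOrder)
open import Relation.Binary.PropositionalEquality using (_≡_; _≢_)
open import Data.Bool using (if_then_else_)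
open import Level using (0ℓ)
open import Function.Bundles using (_⇔_)

-- ℕ^d is represented by Vec ℕ d (coordinates indexed by Fin d, 0-based).
Pt : ℕ → Set
Pt d = Vec ℕ d

_⊕_ : ∀ {d} → Pt d → Pt d → Pt d
_⊕_ = zipWith ℕ._+_

𝟎 : ∀ {d} → Pt d
𝟎 = replicate _ 0

𝐞 : ∀ {d} → Fin d → Pt d
𝐞 i = tabulate (λ j → if does (i F.≟ j) then 1 else 0)

Strict : ∀ {d} → Rel (Pt d) 0ℓ → Rel (Pt d) 0ℓ
Strict _≼_ v w = v ≼ w × v ≢ w

RelaxedMonomialOrder : ∀ {d} → Rel (Pt d) 0ℓ → Set
RelaxedMonomialOrder {d} _≼_ =
  IsTotalOrder _≡_ _≼_
  × (∀ v → 𝟎 ≼ v)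
  × (∀ v w u → Strict _≼_ v w → Strict _≼_ v (w ⊕ u))

-- 1-graded: every n ∉ {0, e_1, …, e_d} is ≻ max{e_1,…,e_d}, i.e. ≻ every e_i
OneGraded : ∀ {d} → Rel (Pt d) 0ℓ → Set
OneGraded {d} _≼_ =
  ∀ (n : Pt d) → n ≢ 𝟎 → (∀ i → n ≢ 𝐞 i) → ∀ i → Strict _≼_ (𝐞 i) n

-- A generalized numerical semigroup, given by its (finite) set of gaps H(S);
-- S = ℕ^d ∖ gaps.
record GNS (d : ℕ) : Set where
  field
    gaps   : List (Pt d)
    unique : Unique gaps
    zero∈S : 𝟎 ∉ gaps
    closed : ∀ x y → x ∉ gaps → y ∉ gaps → (x ⊕ y) ∉ gaps
open GNS public

_≅_ : ∀ {d} → GNS d → GNS d → Set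
S ≅ T = ∀ x → (x ∈ gaps S ⇔ x ∈ gaps T)

-- action of a permutation: σ(Σ x_i e_i) = Σ x_i e_{σ(i)}, so σ(x)_j = x_{σ⁻¹(j)}
act : ∀ {d} → Permutation′ d → Pt d → Pt d
act σ x = tabulate (λ j → lookup x (σ ⟨$⟩ˡ j))

InClass : ∀ {d} → GNS d → GNS d → Set
InClass {d} T S = Σ (Permutation′ d) λ σ → ∀ x → (x ∈ gaps T ⇔ x ∈ map (act σ) (gaps S))

data LexLt {d} (_≺_ : Rel (Pt d) 0ℓ) : List (Pt d) → List (Pt d) → Set where
  here  : ∀ {x y xs ys} → x ≺ y → LexLt _≺_ (x ∷ xs) (y ∷ ys)
  there : ∀ {x xs ys} → LexLt _≺_ xs ys → LexLt _≺_ (x ∷ xs) (x ∷ ys)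

SortedGaps : ∀ {d} → Rel (Pt d) 0ℓ → GNS d → List (Pt d) → Set
SortedGaps _≼_ S L = Linked (Strict _≼_) L × (L ↭ gaps S)

_≼R[_]_ : ∀ {d} → GNS d → Rel (Pt d) 0ℓ → GNS d → Set
S ≼R[ _≼_ ] S' =
  S ≅ S' ⊎ (∀ L L' → SortedGaps _≼_ S L → SortedGaps _≼_ S' L' → LexLt (Strict _≼_) L L')

-- S ∈ R_≼(𝒮_d): S = R_≼(S') = min_{≼_R} [S']_≃ for some GNS S'
InRepresentatives : ∀ {d} → Rel (Pt d) 0ℓ → GNS d → Set
InRepresentatives {d} _≼_ S =
  Σ (GNS d) λ S' → InClass S S' × (∀ T → InClass T S' → S ≼R[ _≼_ ] T)

-- If 𝐞 k is a gap of a representative S but 𝐞 j is not, for j < k, swap the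
-- coordinates j and k to get T in the class of S with H(T) ≠ H(S).  Since S is
-- ≼_R-minimal, the first position where the sorted gap lists differ carries a
-- gap x of S that is not a gap of T, and every gap of T below x is a gap of S.
-- As 𝐞 j is a gap of T but not of S, 𝐞 j ⊀ x, so by 1-gradedness x is 0 or a
-- basis vector; but 0 ∈ S, x = 𝐞 j is not a gap, x = 𝐞 k lies above 𝐞 j, and
-- any other 𝐞 i is fixed by the swap.  Hence the indices of basis gaps are
-- downward closed, i.e. an initial segment.
module Submission where

open import Defs
open import Data.Nat using (ℕ; _≤_; _<_; z≤n; s≤s)
import Data.Nat as ℕ
open import Data.Fin using (Fin; toℕ)
import Data.Fin as F
open import Data.Vec using (Vec; lookup)
open import Data.Vec.Properties using (lookup∘tabulate; tabulate∘lookup; tabulate-cong; lookup-zipWith; lookup-replicate; ≡-dec)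
open import Data.List using (List; _∷_; map)
import Data.List.Properties as List
open import Data.List.Membership.Propositional using (_∈_; _∉_)
open import Data.List.Membership.Propositional.Properties using (∈-map⁺; ∈-map⁻)
open import Data.List.Membership.DecPropositional using (_∈?_)
open import Data.List.Relation.Unary.Any using (here; there)
open import Data.List.Relation.Unary.All using (_∷_)
import Data.List.Relation.Unary.All as All
open import Data.List.Relation.Unary.AllPairs using (AllPairs; _∷_)
open import Data.List.Relation.Unary.Linked using (Linked; []; [-]; _∷_)
open import Data.List.Relation.Unary.Linked.Properties using (Linked⇒AllPairs)
open import Data.List.Relation.Unary.Unique.Propositional using (Unique)
import Data.List.Relation.Unary.Unique.Propositional.Properties as Unique
open import Data.List.Relation.Binary.Permutation.Propositional using (_↭_; ↭-sym; ↭⇒↭ₛ)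
open import Data.List.Relation.Binary.Permutation.Propositional.Properties using (∈-resp-↭)
open import Data.List.Relation.Binary.Permutation.Setoid.Properties using (Unique-resp-↭)
import Data.List.Sort as Sort
open import Data.Fin.Permutation using (Permutation′; _⟨$⟩ˡ_; _⟨$⟩ʳ_; flip; inverseˡ; inverseʳ; _∘ₚ_; transpose)
import Data.Fin.Permutation.Components as PC
open import Data.Product using (Σ; _×_; _,_)
open import Data.Sum using (inj₁; inj₂)
open import Data.Empty using (⊥-elim)
open import Data.Bool using (if_then_else_)
open import Relation.Nullary using (¬_; does; yes; no; contradiction)
open import Relation.Nullary.Decidable using (does-⇔; dec-true; dec-false; decidable-stable)
open import Relation.Unary using (Decidable)
open import Relation.Binary using (Rel; IsTotalOrder; DecTotalOrder; Transitive; Asymmetric)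
open import Relation.Binary.Consequences using (total∧dec⇒dec)
open import Relation.Binary.Construct.NonStrictToStrict using (<-trans; <-asym)
open import Relation.Binary.PropositionalEquality using (_≡_; _≢_; refl; sym; trans; cong; cong₂; subst; setoid; module ≡-Reasoning)
open import Level using (0ℓ)
open import Function.Base using (_∘_)
open import Function.Bundles using (_⇔_; mk⇔; Equivalence)
open import Data.List.Relation.Binary.BagAndSetEquality using (map-cong)
open Equivalence using (to; from)

lookup-ext : ∀ {A : Set} {n} {u v : Vec A n} → (∀ i → lookup u i ≡ lookup v i) → u ≡ v
lookup-ext {u = u} {v} u≗v =
  trans (sym (tabulate∘lookup u)) (trans (tabulate-cong u≗v) (tabulate∘lookup v))

module _ {d : ℕ} where

  lookup-act : (σ : Permutation′ d) (x : Pt d) (m : Fin d) → lookup (act σ x) m ≡ lookup x (σ ⟨$⟩ˡ m)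
  lookup-act σ x = lookup∘tabulate _

  act-∘ₚ : (σ τ : Permutation′ d) (x : Pt d) → act (σ ∘ₚ τ) x ≡ act τ (act σ x)
  act-∘ₚ σ τ x = lookup-ext λ m →
    trans (lookup-act (σ ∘ₚ τ) x m) (sym (trans (lookup-act τ (act σ x) m) (lookup-act σ x _)))

  act-inverseˡ : (σ : Permutation′ d) (x : Pt d) → act (flip σ) (act σ x) ≡ x
  act-inverseˡ σ x = lookup-ext λ m →
    trans (lookup-act (flip σ) (act σ x) m) (trans (lookup-act σ x _) (cong (lookup x) (inverseˡ σ)))

  act-inverseʳ : (σ : Permutation′ d) (x : Pt d) → act σ (act (flip σ) x) ≡ x
  act-inverseʳ σ = act-inverseˡ (flip σ)

  act-injective : (σ : Permutation′ d) {x y : Pt d} → act σ x ≡ act σ y → x ≡ y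
  act-injective σ {x} {y} σx≡σy =
    trans (sym (act-inverseˡ σ x)) (trans (cong (act (flip σ)) σx≡σy) (act-inverseˡ σ y))

  act-⊕ : (σ : Permutation′ d) (x y : Pt d) → act σ (x ⊕ y) ≡ act σ x ⊕ act σ y
  act-⊕ σ x y = lookup-ext λ m → begin
    lookup (act σ (x ⊕ y)) m                        ≡⟨ lookup-act σ (x ⊕ y) m ⟩
    lookup (x ⊕ y) (σ ⟨$⟩ˡ m)                        ≡⟨ lookup-zipWith ℕ._+_ _ x y ⟩
    lookup x (σ ⟨$⟩ˡ m) ℕ.+ lookup y (σ ⟨$⟩ˡ m)       ≡⟨ cong₂ ℕ._+_ (lookup-act σ x m) (lookup-act σ y m) ⟨
    lookup (act σ x) m ℕ.+ lookup (act σ y) m       ≡⟨ lookup-zipWith ℕ._+_ m (act σ x) (act σ y) ⟨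
    lookup (act σ x ⊕ act σ y) m                    ∎
    where
    open ≡-Reasoning

  act-𝟎 : (σ : Permutation′ d) → act σ 𝟎 ≡ 𝟎
  act-𝟎 σ = lookup-ext λ m →
    trans (lookup-act σ 𝟎 m) (trans (lookup-replicate {n = d} _ 0) (sym (lookup-replicate {n = d} m 0)))

  lookup-𝐞 : (i m : Fin d) → lookup (𝐞 i) m ≡ (if does (i F.≟ m) then 1 else 0)
  lookup-𝐞 i = lookup∘tabulate _

  act-𝐞 : (σ : Permutation′ d) (i : Fin d) → act σ (𝐞 i) ≡ 𝐞 (σ ⟨$⟩ʳ i)
  act-𝐞 σ i = lookup-ext λ m → begin
    lookup (act σ (𝐞 i)) m                          ≡⟨ lookup-act σ (𝐞 i) m ⟩
    lookup (𝐞 i) (σ ⟨$⟩ˡ m)                          ≡⟨ lookup-𝐞 i _ ⟩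
    (if does (i F.≟ σ ⟨$⟩ˡ m) then 1 else 0)        ≡⟨ cong (if_then 1 else 0) (same-test m) ⟩
    (if does (σ ⟨$⟩ʳ i F.≟ m) then 1 else 0)        ≡⟨ lookup-𝐞 (σ ⟨$⟩ʳ i) m ⟨
    lookup (𝐞 (σ ⟨$⟩ʳ i)) m                          ∎
    where
    open ≡-Reasoning
    same-test : ∀ m → does (i F.≟ σ ⟨$⟩ˡ m) ≡ does (σ ⟨$⟩ʳ i F.≟ m)
    same-test m = does-⇔ (mk⇔ (λ { refl → inverseʳ σ }) (λ { refl → sym (inverseˡ σ) }))
                           (i F.≟ σ ⟨$⟩ˡ m) (σ ⟨$⟩ʳ i F.≟ m)

  ∈-map-act : (σ : Permutation′ d) {x : Pt d} {xs : List (Pt d)} →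
    x ∈ map (act σ) xs ⇔ act (flip σ) x ∈ xs
  ∈-map-act σ {x} {xs} = mk⇔ unmove move
    where
    unmove : x ∈ map (act σ) xs → act (flip σ) x ∈ xs
    unmove x∈σxs with ∈-map⁻ (act σ) x∈σxs
    ... | y , y∈xs , refl = subst (_∈ xs) (sym (act-inverseˡ σ y)) y∈xs
    move : act (flip σ) x ∈ xs → x ∈ map (act σ) xs
    move σ⁻¹x∈xs = subst (_∈ map (act σ) xs) (act-inverseʳ σ x) (∈-map⁺ (act σ) σ⁻¹x∈xs)

  permute : Permutation′ d → GNS d → GNS d
  permute σ S = record
    { gaps   = map (act σ) (gaps S)
    ; unique = Unique.map⁺ (act-injective σ) (unique S)
    ; zero∈S = λ 𝟎∈σH → zero∈S S (subst (_∈ gaps S) (act-𝟎 (flip σ)) (to (∈-map-act σ) 𝟎∈σH))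
    ; closed = λ x y x∉σH y∉σH x⊕y∈σH →
        closed S _ _ (x∉σH ∘ from (∈-map-act σ)) (y∉σH ∘ from (∈-map-act σ))
                 (subst (_∈ gaps S) (act-⊕ (flip σ) x y) (to (∈-map-act σ) x⊕y∈σH))
    }

  permute-inClass : (τ : Permutation′ d) {S S' : GNS d} → InClass S S' → InClass (permute τ S) S'
  permute-inClass τ {S} {S'} (σ , S≈σS') = σ ∘ₚ τ , τS≈
    where
    τσS'≡ : map (act τ) (map (act σ) (gaps S')) ≡ map (act (σ ∘ₚ τ)) (gaps S')
    τσS'≡ = trans (sym (List.map-∘ (gaps S'))) (sym (List.map-cong (act-∘ₚ σ τ) (gaps S')))
    τS≈ : ∀ x → x ∈ map (act τ) (gaps S) ⇔ x ∈ map (act (σ ∘ₚ τ)) (gaps S')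
    τS≈ x = subst (λ ys → x ∈ map (act τ) (gaps S) ⇔ x ∈ ys) τσS'≡
                  (map-cong (λ _ → refl) (λ {y} → S≈σS' y))

record FirstDifference {A : Set} (_≺_ : Rel A 0ℓ) (xs ys : List A) : Set where
  field
    point     : A
    point∈xs  : point ∈ xs
    point∉ys  : point ∉ ys
    below⇒∈xs : ∀ {z} → z ≺ point → z ∈ ys → z ∈ xs

module _ {A : Set} {_≺_ : Rel A 0ℓ} where
  open FirstDifference

  FirstDifference-resp-↭ : ∀ {xs xs' ys ys'} → xs ↭ xs' → ys ↭ ys' →
    FirstDifference _≺_ xs ys → FirstDifference _≺_ xs' ys'
  FirstDifference-resp-↭ xs↭xs' ys↭ys' δ = record
    { point     = point δ
    ; point∈xs  = ∈-resp-↭ xs↭xs' (point∈xs δ)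
    ; point∉ys  = point∉ys δ ∘ ∈-resp-↭ (↭-sym ys↭ys')
    ; below⇒∈xs = λ z≺p → ∈-resp-↭ xs↭xs' ∘ below⇒∈xs δ z≺p ∘ ∈-resp-↭ (↭-sym ys↭ys')
    }

  ∷-FirstDifference : ∀ {x xs ys} (δ : FirstDifference _≺_ xs ys) → point δ ≢ x →
    FirstDifference _≺_ (x ∷ xs) (x ∷ ys)
  ∷-FirstDifference δ p≢x = record
    { point     = point δ
    ; point∈xs  = there (point∈xs δ)
    ; point∉ys  = λ { (here p≡x) → p≢x p≡x ; (there p∈ys) → point∉ys δ p∈ys }
    ; below⇒∈xs = λ { _ (here refl) → here refl ; z≺p (there z∈ys) → there (below⇒∈xs δ z≺p z∈ys) }
    }

module _ {d : ℕ} {_≺_ : Rel (Pt d) 0ℓ} (≺-trans : Transitive _≺_) (≺-asym : Asymmetric _≺_) where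

  head-minimal : ∀ {y ys z} → AllPairs _≺_ (y ∷ ys) → z ∈ y ∷ ys → ¬ z ≺ y
  head-minimal _             (here refl)  z≺z = ≺-asym z≺z z≺z
  head-minimal (y≺ys ∷ _) (there z∈ys) z≺y = ≺-asym z≺y (All.lookup y≺ys z∈ys)

  lexLt⇒FirstDifference : ∀ {xs ys} → AllPairs _≺_ xs → AllPairs _≺_ ys → LexLt _≺_ xs ys →
    FirstDifference _≺_ xs ys
  lexLt⇒FirstDifference {x ∷ _} _ ys↗ (here x≺y) = record
    { point     = x
    ; point∈xs  = here refl
    ; point∉ys  = λ x∈ys → head-minimal ys↗ x∈ys x≺y
    ; below⇒∈xs = λ z≺x z∈ys → ⊥-elim (head-minimal ys↗ z∈ys (≺-trans z≺x x≺y))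
    }
  lexLt⇒FirstDifference (x≺xs ∷ xs↗) (_ ∷ ys↗) (there xs<ys) =
    ∷-FirstDifference δ λ { refl → ≺-asym x≺p x≺p }
    where
    δ : FirstDifference _≺_ _ _
    δ = lexLt⇒FirstDifference xs↗ ys↗ xs<ys
    x≺p : _ ≺ FirstDifference.point δ
    x≺p = All.lookup x≺xs (FirstDifference.point∈xs δ)

sorted∧unique⇒strictlySorted : ∀ {A : Set} {_≤_ : Rel A 0ℓ} {xs} → Linked _≤_ xs → Unique xs →
  Linked (λ x y → x ≤ y × x ≢ y) xs
sorted∧unique⇒strictlySorted []         _                  = []
sorted∧unique⇒strictlySorted [-]        _                  = [-]
sorted∧unique⇒strictlySorted (x≤y ∷ ↗) ((x≢y ∷ _) ∷ uniq) =
  (x≤y , x≢y) ∷ sorted∧unique⇒strictlySorted ↗ uniq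

module _ {d : ℕ} {_≼_ : Rel (Pt d) 0ℓ} (isTotalOrder : IsTotalOrder _≡_ _≼_) where
  open IsTotalOrder isTotalOrder using (isPartialOrder; antisym; total; reflexive)

  decTotalOrder : DecTotalOrder 0ℓ 0ℓ 0ℓ
  decTotalOrder = record
    { isDecTotalOrder = record
      { isTotalOrder = isTotalOrder
      ; _≟_          = ≡-dec ℕ._≟_
      ; _≤?_         = total∧dec⇒dec reflexive antisym total (≡-dec ℕ._≟_)
      }
    }

  sortGaps : (S : GNS d) → Σ (List (Pt d)) (SortedGaps _≼_ S)
  sortGaps S = sort (gaps S) , sorted∧unique⇒strictlySorted (sort-↗ (gaps S)) uniq , sort-↭ (gaps S)
    where
    open Sort decTotalOrder using (sort; sort-↗; sort-↭)
    uniq : Unique (sort (gaps S))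
    uniq = Unique-resp-↭ (setoid (Pt d)) (↭⇒↭ₛ (↭-sym (sort-↭ (gaps S)))) (unique S)

  ≼R⇒FirstDifference : ∀ {S T} → S ≼R[ _≼_ ] T → ¬ S ≅ T →
    FirstDifference (Strict _≼_) (gaps S) (gaps T)
  ≼R⇒FirstDifference (inj₁ S≅T) S≇T = contradiction S≅T S≇T
  ≼R⇒FirstDifference {S} {T} (inj₂ S<T) _ with sortGaps S | sortGaps T
  ... | L , L↗ , L↭S | L' , L'↗ , L'↭T =
    FirstDifference-resp-↭ L↭S L'↭T
      (lexLt⇒FirstDifference ≺-trans ≺-asym (Linked⇒AllPairs ≺-trans L↗) (Linked⇒AllPairs ≺-trans L'↗)
        (S<T L L' (L↗ , L↭S) (L'↗ , L'↭T)))
    where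
    ≺-trans : Transitive (Strict _≼_)
    ≺-trans = <-trans _≡_ _≼_ isPartialOrder
    ≺-asym : Asymmetric (Strict _≼_)
    ≺-asym = <-asym _≡_ _≼_ antisym

module _ {n : ℕ} where

  transpose-matchˡ : (i j : Fin n) → PC.transpose i j i ≡ j
  transpose-matchˡ i j rewrite dec-true (i F.≟ i) refl = refl

  transpose-matchʳ : (i j : Fin n) → PC.transpose i j j ≡ i
  transpose-matchʳ i j with j F.≟ i
  ... | yes j≡i = j≡i
  ... | no _ rewrite dec-true (j F.≟ j) refl = refl

  transpose-noMatch : (i j k : Fin n) → k ≢ i → k ≢ j → PC.transpose i j k ≡ k
  transpose-noMatch i j k k≢i k≢j rewrite dec-false (k F.≟ i) k≢i | dec-false (k F.≟ j) k≢j = refl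

module Swap {d : ℕ} (S : GNS d) (j k : Fin d) where

  swapped : GNS d
  swapped = permute (transpose j k) S

  𝐞-∈-swapped : ∀ i → 𝐞 i ∈ gaps swapped ⇔ 𝐞 (PC.transpose k j i) ∈ gaps S
  𝐞-∈-swapped i =
    subst (λ y → 𝐞 i ∈ gaps swapped ⇔ y ∈ gaps S) (act-𝐞 (flip (transpose j k)) i)
          (∈-map-act (transpose j k))

  𝐞k∈S⇒𝐞j∈swapped : 𝐞 k ∈ gaps S → 𝐞 j ∈ gaps swapped
  𝐞k∈S⇒𝐞j∈swapped = from (𝐞-∈-swapped j) ∘ subst (_∈ gaps S) (cong 𝐞 (sym (transpose-matchʳ k j)))

  𝐞k∈swapped⇒𝐞j∈S : 𝐞 k ∈ gaps swapped → 𝐞 j ∈ gaps S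
  𝐞k∈swapped⇒𝐞j∈S = subst (_∈ gaps S) (cong 𝐞 (transpose-matchˡ k j)) ∘ to (𝐞-∈-swapped k)

  𝐞-fixed-∈-swapped : ∀ {i} → i ≢ j → i ≢ k → 𝐞 i ∈ gaps S → 𝐞 i ∈ gaps swapped
  𝐞-fixed-∈-swapped {i} i≢j i≢k =
    from (𝐞-∈-swapped i) ∘ subst (_∈ gaps S) (cong 𝐞 (sym (transpose-noMatch k j i i≢k i≢j)))

  swapped-≇ : 𝐞 j ∉ gaps S → 𝐞 k ∈ gaps S → ¬ S ≅ swapped
  swapped-≇ 𝐞j∉S 𝐞k∈S S≅T = 𝐞j∉S (𝐞k∈swapped⇒𝐞j∈S (to (S≅T (𝐞 k)) 𝐞k∈S))

  module _ {_≼_ : Rel (Pt d) 0ℓ} (oneGraded : OneGraded _≼_)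
           (𝐞-increasing : ∀ i i' → i F.< i' → Strict _≼_ (𝐞 i) (𝐞 i')) where
    open FirstDifference

    swapped-noFirstDifference : j F.< k → 𝐞 j ∉ gaps S → 𝐞 k ∈ gaps S →
      ¬ FirstDifference (Strict _≼_) (gaps S) (gaps swapped)
    swapped-noFirstDifference j<k 𝐞j∉S 𝐞k∈S δ = 𝐞j⊀x (oneGraded x x≢𝟎 x≢𝐞 j)
      where
      x : Pt d
      x = point δ
      𝐞j⊀x : ¬ Strict _≼_ (𝐞 j) x
      𝐞j⊀x 𝐞j≺x = 𝐞j∉S (below⇒∈xs δ 𝐞j≺x (𝐞k∈S⇒𝐞j∈swapped 𝐞k∈S))
      x∈S : x ∈ gaps S
      x∈S = point∈xs δ
      x≢𝟎 : x ≢ 𝟎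
      x≢𝟎 x≡𝟎 = zero∈S S (subst (_∈ gaps S) x≡𝟎 x∈S)
      x≢𝐞 : ∀ i → x ≢ 𝐞 i
      x≢𝐞 i x≡𝐞i with i F.≟ j | i F.≟ k
      ... | yes refl | _        = 𝐞j∉S (subst (_∈ gaps S) x≡𝐞i x∈S)
      ... | no _     | yes refl = 𝐞j⊀x (subst (Strict _≼_ (𝐞 j)) (sym x≡𝐞i) (𝐞-increasing j k j<k))
      ... | no i≢j   | no i≢k   = point∉ys δ (subst (_∈ gaps swapped) (sym x≡𝐞i)
                                    (𝐞-fixed-∈-swapped i≢j i≢k (subst (_∈ gaps S) x≡𝐞i x∈S)))

DownClosed : ∀ {n} → (Fin n → Set) → Set
DownClosed P = ∀ {j k} → j F.< k → P k → P j

downClosed⇒initialSegment : ∀ {n} (P : Fin n → Set) → Decidable P → DownClosed P →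
  Σ ℕ λ r → r ≤ n × (∀ i → P i ⇔ toℕ i < r)
downClosed⇒initialSegment {ℕ.zero} P P? down = 0 , z≤n , λ ()
downClosed⇒initialSegment {ℕ.suc n} P P? down with P? F.zero
... | no ¬P0 = 0 , z≤n , λ i → mk⇔ (λ Pi → contradiction (P-zero i Pi) ¬P0) λ ()
  where
  P-zero : ∀ i → P i → P F.zero
  P-zero F.zero    = λ P0 → P0
  P-zero (F.suc i) = down (s≤s z≤n)
... | yes P0 with downClosed⇒initialSegment (P ∘ F.suc) (P? ∘ F.suc) (down ∘ s≤s)
...   | r , r≤n , P∘suc⇔<r = ℕ.suc r , s≤s r≤n , λ
        { F.zero    → mk⇔ (λ _ → s≤s z≤n) (λ _ → P0)
        ; (F.suc i) → mk⇔ (s≤s ∘ to (P∘suc⇔<r i)) (λ { (s≤s i<r) → from (P∘suc⇔<r i) i<r })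
        }

𝐞-∈?-gaps : ∀ {d} (S : GNS d) → Decidable (λ i → 𝐞 i ∈ gaps S)
𝐞-∈?-gaps S i = _∈?_ (≡-dec ℕ._≟_) (𝐞 i) (gaps S)

module _ {d : ℕ} {_≼_ : Rel (Pt d) 0ℓ} (isTotalOrder : IsTotalOrder _≡_ _≼_) (oneGraded : OneGraded _≼_)
         (𝐞-increasing : ∀ i j → i F.< j → Strict _≼_ (𝐞 i) (𝐞 j)) where

  representative-𝐞-gaps-downClosed : (S : GNS d) → InRepresentatives _≼_ S → DownClosed (λ i → 𝐞 i ∈ gaps S)
  representative-𝐞-gaps-downClosed S (S' , S∈[S'] , S-least) {j} {k} j<k 𝐞k∈S =
    decidable-stable (𝐞-∈?-gaps S j) λ 𝐞j∉S →
      swapped-noFirstDifference oneGraded 𝐞-increasing j<k 𝐞j∉S 𝐞k∈S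
        (≼R⇒FirstDifference isTotalOrder {S} {swapped}
          (S-least swapped (permute-inClass (transpose j k) {S} {S'} S∈[S']))
          (swapped-≇ 𝐞j∉S 𝐞k∈S))
    where open Swap S j k

mainTheorem12 : (d : ℕ) → 1 ≤ d → (_≼_ : Rel (Vec ℕ d) 0ℓ)
    → RelaxedMonomialOrder _≼_ → OneGraded _≼_
    → (∀ (i j : Fin d) → i F.< j → Strict _≼_ (𝐞 i) (𝐞 j))
    → (S : GNS d) → InRepresentatives _≼_ S
    → Σ ℕ (λ r → r ≤ d × (∀ (i : Fin d) → (𝐞 i ∈ gaps S ⇔ toℕ i < r)))
mainTheorem12 d _ _≼_ (isTotalOrder , _ , _) oneGraded 𝐞-increasing S S-rep =
  downClosed⇒initialSegment (λ i → 𝐞 i ∈ gaps S) (𝐞-∈?-gaps S)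
    (representative-𝐞-gaps-downClosed isTotalOrder oneGraded 𝐞-increasing S S-rep)
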